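{- Let $r,s,a,n$ be positive integers such that $n\geq r(s+2)$ and $r,s\geq 2$. Let $G\in \mathcal{F}\left(n+1, s+1,\Sigma_{r,0}(a,s+1) \right)$. Then either $G\in \mathcal{F}\left(n+1, s, \Sigma_{r,0}(a,s)\right)$ or $G$ contains a vertex of product-degree strictly less than \[\left(\frac{a}{a+1}\right)^{\frac{n-r(s+2)}{rs}}\cdot\frac{\Pi_{r,0}(a,n+1)}{\Pi_{r,0}(a,n)}.\]
   Context: A multigraph is a pair $G=(V,w)$ where $V$ is a finite set and $w:\binom{V}{2}\to\mathbb{Z}_{\geq 0}$. For $X\subseteq V$ write $e(G[X])=\sum_{xy\in\binom{X}{2}}w(xy)$, $e(G)=e(G[V])$ and $P(G)=\prod_{xy\in\binom{V}{2}}w(xy)$. The product-degree of a vertex $v$ is $p_G(v)=\prod_{u\in V\setminus\{v\}}w(uv)$. Given integers $s\geq 2$, $q\geq 0$, $\mathcal{F}(n,s,q)$ denotes the set of multigraphs on vertex set $[n]=\{1,\dots,n\}$ in which every $s$-set $X$ of vertices satisfies $e(G[X])\leq q$. For positive integers $a,r,n$, $\mathcal{T}_{r,0}(a,n)$ is the set of multigraphs $G$ on $[n]$ whose vertex set can be partitioned into $r$ parts $V_0,\dots,V_{r-1}$ such that all pairs inside some $V_i$ have multiplicity $a$ and all other pairs have multiplicity $a+1$. $\Sigma_{r,0}(a,n)=\max\{e(G):G\in\mathcal{T}_{r,0}(a,n)\}$ and $\Pi_{r,0}(a,n)=\max\{P(G):G\in\mathcal{T}_{r,0}(a,n)\}$.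 -}

module Defs where

open import Data.Nat using (ℕ; zero; suc; _+_; _*_; _⊔_; _<ᵇ_; _≤_)
open import Data.Bool using (Bool; true; false; if_then_else_; _∧_)
open import Data.Fin using (Fin; toℕ)
open import Data.Fin.Properties using () renaming (_≟_ to _≟F_)
open import Data.Fin.Subset using (Subset; ∣_∣)
open import Data.Vec using (Vec; []; _∷_; lookup)
open import Data.List using (List; []; _∷_; map; foldr; concatMap; allFin)
open import Data.Nat.ListAction using (sum; product)
open import Relation.Nullary.Decidable using (⌊_⌋)
open import Relation.Binary.PropositionalEquality using (_≡_)

-- A multigraph on vertex set Fin N ( = [N] ).  Only the values w i j with i ≠ j
-- are ever used; w is required to be symmetric so it represents a function on
-- unordered pairs.
record Multigraph (N : ℕ) : Set where
  field
    w   : Fin N → Fin N → ℕ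
    sym : ∀ i j → w i j ≡ w j i
open Multigraph public

pairSum : ∀ {N} → (Fin N → Bool) → (Fin N → Fin N → ℕ) → ℕ
pairSum {N} X f =
  sum (map (λ i → sum (map (λ j →
    if X i ∧ X j ∧ (toℕ i <ᵇ toℕ j) then f i j else 0) (allFin N))) (allFin N))

pairProd : ∀ {N} → (Fin N → Fin N → ℕ) → ℕ
pairProd {N} f =
  product (map (λ i → product (map (λ j →
    if toℕ i <ᵇ toℕ j then f i j else 1) (allFin N))) (allFin N))

eSub : ∀ {N} → Multigraph N → Subset N → ℕ
eSub G X = pairSum (lookup X) (w G)

pdeg : ∀ {N} → Multigraph N → Fin N → ℕ
pdeg {N} G v = product (map (λ u → if ⌊ u ≟F v ⌋ then 1 else w G u v) (allFin N))

InF : ∀ {N} → Multigraph N → ℕ → ℕ → Set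
InF {N} G s q = (X : Subset N) → ∣ X ∣ ≡ s → eSub G X ≤ q

-- all assignments of the n vertices to r (labelled, possibly empty) parts
allAssign : (r n : ℕ) → List (Vec (Fin r) n)
allAssign r zero = [] ∷ []
allAssign r (suc n) = concatMap (λ v → map (_∷ v) (allFin r)) (allAssign r n)

-- the multiplicity function of the graph in T_{r,0}(a,n) given by partition f
tWeight : ∀ {r n} → ℕ → Vec (Fin r) n → Fin n → Fin n → ℕ
tWeight a f i j = if ⌊ lookup f i ≟F lookup f j ⌋ then a else suc a

maxList : List ℕ → ℕ
maxList = foldr _⊔_ 0

Σr0 : ℕ → ℕ → ℕ → ℕ
Σr0 r a n = maxList (map (λ f → pairSum (λ _ → true) (tWeight a f)) (allAssign r n))

Πr0 : ℕ → ℕ → ℕ → ℕ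
Πr0 r a n = maxList (map (λ f → pairProd (tWeight a f)) (allAssign r n))

-- Suppose an s-set X spans more than Σ_{r,0}(a,s) edges although every product-degree is
-- large. A product-degree is a product of n multiplicities, and Bernoulli's inequality gives
-- x ≤ a ((a+1)/a)^(x−a) for every natural x, so ∏_{v∈X} p(v) ≤ a^(ns) ((a+1)/a)^(∑_{v∈X} d(v) − ans).
-- The degrees over X count e(G[X]) twice plus the edges leaving X, and each outside vertex
-- sends at most Σ_{r,0}(a,s+1) − e(G[X]) edges into X. Extremal partitions control the rest:
-- deleting a vertex from a largest part compares Σ_{r,0}(a,s+1) with Σ_{r,0}(a,s), adding one
-- to a smallest part compares Π_{r,0}(a,n+1) with Π_{r,0}(a,n), and Cauchy–Schwarz bounds the
-- pairs inside parts. Raised to the power rs, the lower and upper bounds on ∏_{v∈X} p(v) become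
-- a^X (a+1)^Y with equal X + Y, but the upper one has the strictly larger X and is therefore
-- strictly smaller: a contradiction.

module Submission where

open import Defs hiding (sym)
open import Data.Nat
open import Data.Nat.Properties
open import Algebra.Properties.Semiring.Sum +-*-semiring
  using (sum; sum-cong-≗; ∑-distrib-+; ∑-comm; *-distribˡ-sum)
open import Algebra.Properties.CommutativeMonoid.Sum *-1-commutativeMonoid
  using () renaming (sum to product; sum-cong-≗ to product-cong-≗)
open import Algebra.Properties.CommutativeSemigroup +-commutativeSemigroup
  using () renaming (interchange to +-interchange)
open import Algebra.Properties.CommutativeSemigroup *-commutativeSemigroup
  using () renaming (interchange to *-interchange)
open import Data.Bool using (Bool; true; false; if_then_else_; _∧_)
open import Data.Empty using (⊥; ⊥-elim)
open import Data.Fin using (Fin; zero; suc; toℕ)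
open import Data.Fin.Properties using (any?; toℕ-injective; nonZeroIndex) renaming (_≟_ to _≟F_)
open import Data.Fin.Subset using (Subset; ∣_∣)
open import Data.List using ([]; _∷_; map; allFin; tabulate)
open import Data.List.Properties using (map-tabulate; map-cong)
open import Data.List.Membership.Propositional using (_∈_)
open import Data.List.Membership.Propositional.Properties using (∈-map⁺; ∈-map⁻; ∈-concatMap⁺; ∈-allFin)
open import Data.List.Relation.Unary.Any using (here; there)
import Data.List.Relation.Unary.Any as Any
import Data.Nat.ListAction as List
open import Data.Nat.Tactic.RingSolver using (solve-∀)
open import Data.Product using (Σ; ∃₂; ∃-syntax; _×_; _,_)
open import Data.Sum using (_⊎_; inj₁; inj₂)
open import Data.Vec using (Vec; []; _∷_; lookup; replicate; _[_]≔_)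
open import Data.Vec.Properties using (lookup∘update; lookup∘update′)
open import Function using (id; _∘_)
open import Relation.Binary.PropositionalEquality
open import Relation.Nullary using (¬_; yes; no; ofʸ; ofⁿ)
open import Relation.Nullary.Decidable using (⌊_⌋; decidable-stable)

-- Sums and products over Fin n

sum-tabulate : ∀ n (h : Fin n → ℕ) → List.sum (tabulate h) ≡ sum h
sum-tabulate zero    h = refl
sum-tabulate (suc n) h = cong (h zero +_) (sum-tabulate n (h ∘ suc))

product-tabulate : ∀ n (h : Fin n → ℕ) → List.product (tabulate h) ≡ product h
product-tabulate zero    h = refl
product-tabulate (suc n) h = cong (h zero *_) (product-tabulate n (h ∘ suc))

sum-allFin : ∀ {n} (h : Fin n → ℕ) → List.sum (map h (allFin n)) ≡ sum h
sum-allFin {n} h = trans (cong List.sum (map-tabulate id h)) (sum-tabulate n h)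

product-allFin : ∀ {n} (h : Fin n → ℕ) → List.product (map h (allFin n)) ≡ product h
product-allFin {n} h = trans (cong List.product (map-tabulate id h)) (product-tabulate n h)

sum-const : ∀ n c → sum {n} (λ _ → c) ≡ n * c
sum-const zero    c = refl
sum-const (suc n) c = cong (c +_) (sum-const n c)

sum-zero : ∀ {n} {h : Fin n → ℕ} → (∀ i → h i ≡ 0) → sum h ≡ 0
sum-zero {n} h≡0 = trans (sum-cong-≗ h≡0) (trans (sum-const n 0) (*-zeroʳ n))

sum-mono-≤ : ∀ {n} {h g : Fin n → ℕ} → (∀ i → h i ≤ g i) → sum h ≤ sum g
sum-mono-≤ {zero}  h≤g = z≤n
sum-mono-≤ {suc n} h≤g = +-mono-≤ (h≤g zero) (sum-mono-≤ (h≤g ∘ suc))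

≟-suc : ∀ {n} (x y : Fin n) → ⌊ suc x ≟F suc y ⌋ ≡ ⌊ x ≟F y ⌋
≟-suc x y with x ≟F y
... | yes _ = refl
... | no  _ = refl

≟-refl : ∀ {n} (x : Fin n) → ⌊ x ≟F x ⌋ ≡ true
≟-refl zero    = refl
≟-refl (suc x) = trans (≟-suc x x) (≟-refl x)

≟-≢ : ∀ {n} {x y : Fin n} → x ≢ y → ⌊ x ≟F y ⌋ ≡ false
≟-≢ {x = x} {y} x≢y with x ≟F y
... | yes x≡y = ⊥-elim (x≢y x≡y)
... | no  _   = refl

≟-sym : ∀ {n} (x y : Fin n) → ⌊ x ≟F y ⌋ ≡ ⌊ y ≟F x ⌋
≟-sym x y with x ≟F y | y ≟F x
... | yes _   | yes _   = refl
... | no  _   | no  _   = refl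
... | yes x≡y | no  y≢x = ⊥-elim (y≢x (sym x≡y))
... | no  x≢y | yes y≡x = ⊥-elim (x≢y (sym y≡x))

sum-δ : ∀ {n} (u : Fin n) (h : Fin n → ℕ) → sum (λ i → if ⌊ i ≟F u ⌋ then h i else 0) ≡ h u
sum-δ {suc n} zero    h = trans (cong (h zero +_) (sum-zero {n} (λ _ → refl))) (+-identityʳ _)
sum-δ {suc n} (suc u) h =
  trans (sum-cong-≗ (λ i → cong (if_then h (suc i) else 0) (≟-suc i u))) (sum-δ u (h ∘ suc))

^-distrib-* : ∀ x y k → (x * y) ^ k ≡ x ^ k * y ^ k
^-distrib-* x y zero    = refl
^-distrib-* x y (suc k) = trans (cong (x * y *_) (^-distrib-* x y k)) (*-interchange x y (x ^ k) (y ^ k))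

product-^ : ∀ {n} k (h : Fin n → ℕ) → product (λ i → h i ^ k) ≡ product h ^ k
product-^ {zero}  k h = sym (^-zeroˡ k)
product-^ {suc n} k h =
  trans (cong (h zero ^ k *_) (product-^ k (h ∘ suc))) (sym (^-distrib-* (h zero) _ k))

⟦_⟧ : Bool → ℕ
⟦ b ⟧ = if b then 1 else 0

pairSum≡∑∑ : ∀ {m} (X : Fin m → Bool) (g : Fin m → Fin m → ℕ) →
  pairSum X g ≡ sum λ i → sum λ j → if X i ∧ X j ∧ (toℕ i <ᵇ toℕ j) then g i j else 0
pairSum≡∑∑ {m} X g =
  trans (cong List.sum (map-cong (λ i → sum-allFin (row i)) (allFin m))) (sum-allFin (λ i → sum (row i)))
  where
  row : Fin m → Fin m → ℕ
  row i j = if X i ∧ X j ∧ (toℕ i <ᵇ toℕ j) then g i j else 0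

pairProd≡∏∏ : ∀ {m} (g : Fin m → Fin m → ℕ) →
  pairProd g ≡ product λ i → product λ j → if toℕ i <ᵇ toℕ j then g i j else 1
pairProd≡∏∏ {m} g =
  trans (cong List.product (map-cong (λ i → product-allFin (row i)) (allFin m)))
        (product-allFin (λ i → product (row i)))
  where
  row : Fin m → Fin m → ℕ
  row i j = if toℕ i <ᵇ toℕ j then g i j else 1

pairSum-head : ∀ {m} (g : Fin (suc m) → Fin (suc m) → ℕ) →
  pairSum (λ _ → true) g ≡ sum (λ j → g zero (suc j)) + pairSum (λ _ → true) (λ i j → g (suc i) (suc j))
pairSum-head g = trans (pairSum≡∑∑ (λ _ → true) g)
  (cong (sum (λ j → g zero (suc j)) +_) (sym (pairSum≡∑∑ (λ _ → true) λ i j → g (suc i) (suc j))))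

pairProd-head : ∀ {m} (g : Fin (suc m) → Fin (suc m) → ℕ) →
  pairProd g ≡ product (λ j → g zero (suc j)) * pairProd (λ i j → g (suc i) (suc j))
pairProd-head {m} g = trans (pairProd≡∏∏ g) (cong₂ _*_
  (+-identityʳ (product λ j → g zero (suc j)))
  (trans (product-cong-≗ {m} λ i → +-identityʳ (product λ j → if toℕ i <ᵇ toℕ j then g (suc i) (suc j) else 1))
         (sym (pairProd≡∏∏ λ i j → g (suc i) (suc j)))))

if-sum : ∀ {N} b (h : Fin N → ℕ) → (if b then sum h else 0) ≡ sum (λ u → if b then h u else 0)
if-sum     true  h = refl
if-sum {N} false h = sym (sum-zero {N} λ _ → refl)

product-lower-bound : ∀ {N} (X : Fin N → Bool) (h : Fin N → ℕ) A B → (∀ v → X v ≡ true → A ≤ h v * B) →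
  A ^ sum (λ v → ⟦ X v ⟧) ≤ product (λ v → if X v then h v else 1) * B ^ sum (λ v → ⟦ X v ⟧)
product-lower-bound {zero}  X h A B bound = ≤-refl
product-lower-bound {suc N} X h A B bound =
  step (X zero) (bound zero) (product-lower-bound (X ∘ suc) (h ∘ suc) A B (bound ∘ suc))
  where
  step : ∀ {S P} t → (t ≡ true → A ≤ h zero * B) → A ^ S ≤ P * B ^ S →
         A ^ (⟦ t ⟧ + S) ≤ (if t then h zero else 1) * P * B ^ (⟦ t ⟧ + S)
  step {S} {P} true A≤hB IH = begin
    A * A ^ S                 ≤⟨ *-mono-≤ (A≤hB refl) IH ⟩
    h zero * B * (P * B ^ S)  ≡⟨ *-interchange (h zero) B P (B ^ S) ⟩
    h zero * P * (B * B ^ S)  ∎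
    where open ≤-Reasoning
  step {S} {P} false _ IH = subst (λ t → A ^ S ≤ t * B ^ S) (sym (+-identityʳ P)) IH

sum-upper-bound : ∀ {N} (X : Fin N → Bool) (d : Fin N → ℕ) E M → (∀ u → X u ≡ false → E + d u ≤ M) →
  E * sum (λ u → if X u then 0 else 1) + sum (λ u → if X u then 0 else d u) ≤ M * sum (λ u → if X u then 0 else 1)
sum-upper-bound {N} X d E M bound = subst₂ _≤_
  (trans (∑-distrib-+ (λ u → E * outside u) outsideDegree) (cong (_+ sum outsideDegree) (sym (*-distribˡ-sum E outside))))
  (sym (*-distribˡ-sum M outside))
  (sum-mono-≤ pointwise)
  where
  outside outsideDegree : Fin N → ℕ
  outside u       = if X u then 0 else 1
  outsideDegree u = if X u then 0 else d u
  pointwise : ∀ u → E * (if X u then 0 else 1) + (if X u then 0 else d u) ≤ M * (if X u then 0 else 1)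
  pointwise u with X u in u∉X
  ... | true  = subst₂ _≤_ (sym (trans (+-identityʳ _) (*-zeroʳ E))) (sym (*-zeroʳ M)) z≤n
  ... | false = subst₂ _≤_ (cong (_+ d u) (sym (*-identityʳ E))) (sym (*-identityʳ M)) (bound u u∉X)

amgm-≤ : ∀ {p q} → p ≤ q → 2 * (p * q) ≤ p * p + q * q
amgm-≤ {p} p≤q with m≤n⇒∃[o]m+o≡n p≤q
... | d , refl = subst (2 * (p * (p + d)) ≤_) (ring p d) (m≤m+n (2 * (p * (p + d))) (d * d))
  where ring : ∀ p d → 2 * (p * (p + d)) + d * d ≡ p * p + (p + d) * (p + d)
        ring = solve-∀

amgm : ∀ p q → 2 * (p * q) ≤ p * p + q * q
amgm p q with ≤-total p q
... | inj₁ p≤q = amgm-≤ p≤q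
... | inj₂ q≤p = subst₂ _≤_ (cong (2 *_) (*-comm q p)) (+-comm (q * q) (p * p)) (amgm-≤ q≤p)

-- Multiplied by n, this is AM-GM for n x₀ and S.
cross-term : ∀ n x₀ S Q → S * S ≤ n * Q → 2 * (x₀ * S) ≤ n * (x₀ * x₀) + Q
cross-term zero    x₀ zero    Q _ = subst (_≤ Q) (cong (2 *_) (sym (*-zeroʳ x₀))) z≤n
cross-term (suc n) x₀ S       Q S*S≤nQ = *-cancelˡ-≤ (suc n) (begin
  suc n * (2 * (x₀ * S))                  ≡⟨ ring₁ (suc n) x₀ S ⟩
  2 * (suc n * x₀ * S)                    ≤⟨ amgm (suc n * x₀) S ⟩
  suc n * x₀ * (suc n * x₀) + S * S       ≤⟨ +-monoʳ-≤ (suc n * x₀ * (suc n * x₀)) S*S≤nQ ⟩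
  suc n * x₀ * (suc n * x₀) + suc n * Q   ≡⟨ ring₂ (suc n) x₀ Q ⟩
  suc n * (suc n * (x₀ * x₀) + Q)         ∎)
  where
  open ≤-Reasoning
  ring₁ : ∀ n x S → n * (2 * (x * S)) ≡ 2 * (n * x * S)
  ring₁ = solve-∀
  ring₂ : ∀ n x Q → n * x * (n * x) + n * Q ≡ n * (n * (x * x) + Q)
  ring₂ = solve-∀

cauchy-schwarz : ∀ n (x : Fin n → ℕ) → sum x * sum x ≤ n * sum (λ i → x i * x i)
cauchy-schwarz zero    x = z≤n
cauchy-schwarz (suc n) x = begin
  (x₀ + S) * (x₀ + S)                   ≡⟨ ring₁ x₀ S ⟩
  x₀ * x₀ + 2 * (x₀ * S) + S * S        ≤⟨ +-mono-≤ (+-monoʳ-≤ (x₀ * x₀) (cross-term n x₀ S Q IH)) IH ⟩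
  x₀ * x₀ + (n * (x₀ * x₀) + Q) + n * Q ≡⟨ ring₂ n x₀ Q ⟩
  suc n * (x₀ * x₀ + Q)                 ∎
  where
  open ≤-Reasoning
  x₀ = x zero
  S = sum (x ∘ suc)
  Q = sum (λ i → x (suc i) * x (suc i))
  IH : S * S ≤ n * Q
  IH = cauchy-schwarz n (x ∘ suc)
  ring₁ : ∀ x S → (x + S) * (x + S) ≡ x * x + 2 * (x * S) + S * S
  ring₁ = solve-∀
  ring₂ : ∀ n x Q → x * x + (n * (x * x) + Q) + n * Q ≡ suc n * (x * x + Q)
  ring₂ = solve-∀

powers-* : ∀ x y p q p′ q′ → x ^ p * y ^ q * (x ^ p′ * y ^ q′) ≡ x ^ (p + p′) * y ^ (q + q′)
powers-* x y p q p′ q′ = trans (*-interchange (x ^ p) (y ^ q) (x ^ p′) (y ^ q′))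
  (sym (cong₂ _*_ (^-distribˡ-+-* x p p′) (^-distribˡ-+-* y q q′)))

powers-^ : ∀ x y p q k → (x ^ p * y ^ q) ^ k ≡ x ^ (p * k) * y ^ (q * k)
powers-^ x y p q k = trans (^-distrib-* (x ^ p) (y ^ q) k) (cong₂ _*_ (^-*-assoc x p k) (^-*-assoc y q k))

powers-regroup : ∀ k q t x y → q ^ k * t * (x * y) ^ k ≡ (q * x * y) ^ k * t
powers-regroup k q t x y = begin
  q ^ k * t * (x * y) ^ k         ≡⟨ cong (q ^ k * t *_) (^-distrib-* x y k) ⟩
  q ^ k * t * (x ^ k * y ^ k)     ≡⟨ ring (q ^ k) t (x ^ k) (y ^ k) ⟩
  q ^ k * x ^ k * y ^ k * t       ≡⟨ cong (λ u → u * y ^ k * t) (^-distrib-* q x k) ⟨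
  (q * x) ^ k * y ^ k * t         ≡⟨ cong (_* t) (^-distrib-* (q * x) y k) ⟨
  (q * x * y) ^ k * t             ∎
  where
  open ≡-Reasoning
  ring : ∀ Q t X Y → Q * t * (X * Y) ≡ Q * X * Y * t
  ring = solve-∀

-- Products bounded through Bernoulli's inequality

-- `ProductBound a p σ c` says p ≤ a ^ c · ((a+1)/a) ^ (σ − a c), with denominators
-- cleared and the possibly negative exponent σ − a c replaced by any P − N above it.
record ProductBound (a p σ c : ℕ) : Set where
  field
    bound : ∀ P N → σ + N ≤ a * c + P → p * a ^ P * suc a ^ N ≤ a ^ (c + N) * suc a ^ P
open ProductBound

module _ (a : ℕ) where
  open ≤-Reasoning

  bernoulli : ∀ e → (a + e) * a ^ e ≤ a * suc a ^ e
  bernoulli zero    = ≤-reflexive (cong (_* 1) (+-identityʳ a))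
  bernoulli (suc e) = begin
    (a + suc e) * (a * a ^ e)          ≡⟨ ring₁ a e (a ^ e) ⟩
    ((a + e) * a + a) * a ^ e          ≤⟨ *-monoˡ-≤ (a ^ e) (+-monoʳ-≤ ((a + e) * a) (m≤m+n a e)) ⟩
    ((a + e) * a + (a + e)) * a ^ e    ≡⟨ ring₂ a e (a ^ e) ⟩
    suc a * ((a + e) * a ^ e)          ≤⟨ *-monoʳ-≤ (suc a) (bernoulli e) ⟩
    suc a * (a * suc a ^ e)            ≡⟨ ring₃ a (suc a) (suc a ^ e) ⟩
    a * (suc a * suc a ^ e)            ∎
    where
    ring₁ : ∀ x y z → (x + suc y) * (x * z) ≡ ((x + y) * x + x) * z
    ring₁ = solve-∀
    ring₂ : ∀ x y z → ((x + y) * x + (x + y)) * z ≡ suc x * ((x + y) * z)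
    ring₂ = solve-∀
    ring₃ : ∀ x y z → y * (x * z) ≡ x * (y * z)
    ring₃ = solve-∀

  bernoulli-deficit : ∀ x f → x + f ≤ a → x * suc a ^ f ≤ a * a ^ f
  bernoulli-deficit x zero    x≤a = *-monoˡ-≤ 1 (≤-trans (m≤m+n x 0) x≤a)
  bernoulli-deficit x (suc f) x+1+f≤a = begin
    x * (suc a * suc a ^ f)   ≡⟨ ring₁ x a (suc a ^ f) ⟩
    (x + x * a) * suc a ^ f   ≤⟨ *-monoˡ-≤ (suc a ^ f) (+-monoˡ-≤ (x * a) (≤-trans (m≤m+n x (suc f)) x+1+f≤a)) ⟩
    (a + x * a) * suc a ^ f   ≡⟨ ring₂ x a (suc a ^ f) ⟩
    a * (suc x * suc a ^ f)   ≤⟨ *-monoʳ-≤ a (bernoulli-deficit (suc x) f (subst (_≤ a) (+-suc x f) x+1+f≤a)) ⟩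
    a * (a * a ^ f)           ∎
    where
    ring₁ : ∀ x a z → x * (suc a * z) ≡ (x + x * a) * z
    ring₁ = solve-∀
    ring₂ : ∀ x a z → (a + x * a) * z ≡ a * (suc x * z)
    ring₂ = solve-∀

  single-bound-above : ∀ x N e → x + N ≤ a * 1 + (N + e) →
                x * a ^ (N + e) * suc a ^ N ≤ a ^ (1 + N) * suc a ^ (N + e)
  single-bound-above x N e x+N≤a+N+e = begin
    x * a ^ (N + e) * suc a ^ N          ≡⟨ cong (λ t → x * t * suc a ^ N) (^-distribˡ-+-* a N e) ⟩
    x * (a ^ N * a ^ e) * suc a ^ N      ≡⟨ ring₁ x (a ^ N) (a ^ e) (suc a ^ N) ⟩
    x * a ^ e * (a ^ N * suc a ^ N)      ≤⟨ *-monoˡ-≤ _ (≤-trans (*-monoˡ-≤ (a ^ e) x≤a+e) (bernoulli e)) ⟩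
    a * suc a ^ e * (a ^ N * suc a ^ N)  ≡⟨ ring₂ a (suc a ^ e) (a ^ N) (suc a ^ N) ⟩
    a * a ^ N * (suc a ^ N * suc a ^ e)  ≡⟨ cong (a * a ^ N *_) (^-distribˡ-+-* (suc a) N e) ⟨
    a ^ (1 + N) * suc a ^ (N + e)        ∎
    where
    ring₁ : ∀ x y z w → x * (y * z) * w ≡ x * z * (y * w)
    ring₁ = solve-∀
    ring₂ : ∀ a y z w → a * y * (z * w) ≡ a * z * (w * y)
    ring₂ = solve-∀
    x≤a+e : x ≤ a + e
    x≤a+e = +-cancelʳ-≤ N x (a + e)
      (≤-trans x+N≤a+N+e (≤-reflexive (trans (cong (_+ (N + e)) (*-identityʳ a)) (ring₃ a N e))))
      where ring₃ : ∀ a N e → a + (N + e) ≡ a + e + N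
            ring₃ = solve-∀

  single-bound-below : ∀ x P f → x + (P + f) ≤ a * 1 + P →
                x * a ^ P * suc a ^ (P + f) ≤ a ^ (1 + (P + f)) * suc a ^ P
  single-bound-below x P f x+P+f≤a+P = begin
    x * a ^ P * suc a ^ (P + f)          ≡⟨ cong (x * a ^ P *_) (^-distribˡ-+-* (suc a) P f) ⟩
    x * a ^ P * (suc a ^ P * suc a ^ f)  ≡⟨ ring₁ x (a ^ P) (suc a ^ P) (suc a ^ f) ⟩
    x * suc a ^ f * (a ^ P * suc a ^ P)  ≤⟨ *-monoˡ-≤ _ (bernoulli-deficit x f x+f≤a) ⟩
    a * a ^ f * (a ^ P * suc a ^ P)      ≡⟨ ring₂ a (a ^ f) (a ^ P) (suc a ^ P) ⟩
    a * (a ^ P * a ^ f) * suc a ^ P      ≡⟨ cong (λ t → a * t * suc a ^ P) (^-distribˡ-+-* a P f) ⟨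
    a ^ (1 + (P + f)) * suc a ^ P        ∎
    where
    ring₁ : ∀ x y z w → x * y * (z * w) ≡ x * w * (y * z)
    ring₁ = solve-∀
    ring₂ : ∀ a y z w → a * y * (z * w) ≡ a * (z * y) * w
    ring₂ = solve-∀
    x+f≤a : x + f ≤ a
    x+f≤a = +-cancelʳ-≤ P (x + f) a
      (≤-trans (≤-reflexive (ring₃ x P f)) (≤-trans x+P+f≤a+P (≤-reflexive (cong (_+ P) (*-identityʳ a)))))
      where ring₃ : ∀ x P f → x + f + P ≡ x + (P + f)
            ring₃ = solve-∀

  single-bound : ∀ x → ProductBound a x x 1
  single-bound x .bound P N x+N≤a+P with ≤-total N P
  ... | inj₁ N≤P with m≤n⇒∃[o]m+o≡n N≤P
  ...   | e , refl = single-bound-above x N e x+N≤a+P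
  single-bound x .bound P N x+N≤a+P | inj₂ P≤N with m≤n⇒∃[o]m+o≡n P≤N
  ...   | f , refl = single-bound-below x P f x+N≤a+P

  one-bound : ProductBound a 1 0 0
  one-bound .bound P N N≤a*0+P with m≤n⇒∃[o]m+o≡n (subst (N ≤_) (cong (_+ P) (*-zeroʳ a)) N≤a*0+P)
  ... | e , refl = begin
    1 * a ^ (N + e) * suc a ^ N          ≡⟨ cong (λ t → 1 * t * suc a ^ N) (^-distribˡ-+-* a N e) ⟩
    1 * (a ^ N * a ^ e) * suc a ^ N      ≡⟨ ring (a ^ N) (a ^ e) (suc a ^ N) ⟩
    a ^ N * (suc a ^ N * a ^ e)          ≤⟨ *-monoʳ-≤ (a ^ N) (*-monoʳ-≤ (suc a ^ N) (^-monoˡ-≤ e (n≤1+n a))) ⟩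
    a ^ N * (suc a ^ N * suc a ^ e)      ≡⟨ cong (a ^ N *_) (^-distribˡ-+-* (suc a) N e) ⟨
    a ^ (0 + N) * suc a ^ (N + e)        ∎
    where
    ring : ∀ x y z → 1 * (x * y) * z ≡ x * (z * y)
    ring = solve-∀

module _ (b : ℕ) where
  private
    a = suc b

  combine : ∀ p₁ p₂ c₁ c₂ P N P₁ N₁ →
    p₁ * a ^ P₁ * suc a ^ N₁ ≤ a ^ (c₁ + N₁) * suc a ^ P₁ →
    p₂ * a ^ (P + N₁) * suc a ^ (N + P₁) ≤ a ^ (c₂ + (N + P₁)) * suc a ^ (P + N₁) →
    p₁ * p₂ * a ^ P * suc a ^ N ≤ a ^ ((c₁ + c₂) + N) * suc a ^ P
  combine p₁ p₂ c₁ c₂ P N P₁ N₁ ineq₁ ineq₂ = *-cancelʳ-≤ _ _ K {{>-nonZero K>0}} (begin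
    p₁ * p₂ * a ^ P * suc a ^ N * K
      ≡⟨ ring₁ p₁ p₂ (a ^ P) (suc a ^ N) (a ^ P₁) (a ^ N₁) (suc a ^ P₁) (suc a ^ N₁) ⟩
    p₁ * a ^ P₁ * suc a ^ N₁ * (p₂ * (a ^ P * a ^ N₁) * (suc a ^ N * suc a ^ P₁))
      ≡⟨ cong₂ (λ u v → p₁ * a ^ P₁ * suc a ^ N₁ * (p₂ * u * v)) (^-distribˡ-+-* a P N₁) (^-distribˡ-+-* (suc a) N P₁) ⟨
    p₁ * a ^ P₁ * suc a ^ N₁ * (p₂ * a ^ (P + N₁) * suc a ^ (N + P₁))
      ≤⟨ *-mono-≤ ineq₁ ineq₂ ⟩
    a ^ (c₁ + N₁) * suc a ^ P₁ * (a ^ (c₂ + (N + P₁)) * suc a ^ (P + N₁))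
      ≡⟨ cong₂ (λ u v → u * suc a ^ P₁ * v) (^-distribˡ-+-* a c₁ N₁)
           (cong₂ _*_ (trans (^-distribˡ-+-* a c₂ (N + P₁)) (cong (a ^ c₂ *_) (^-distribˡ-+-* a N P₁)))
                      (^-distribˡ-+-* (suc a) P N₁)) ⟩
    a ^ c₁ * a ^ N₁ * suc a ^ P₁ * (a ^ c₂ * (a ^ N * a ^ P₁) * (suc a ^ P * suc a ^ N₁))
      ≡⟨ ring₂ (a ^ c₁) (a ^ c₂) (a ^ N) (a ^ P) (a ^ P₁) (a ^ N₁) (suc a ^ P₁) (suc a ^ N₁) (suc a ^ P) ⟩
    a ^ c₁ * a ^ c₂ * a ^ N * suc a ^ P * K
      ≡⟨ cong (λ u → u * suc a ^ P * K) (trans (^-distribˡ-+-* a (c₁ + c₂) N) (cong (_* a ^ N) (^-distribˡ-+-* a c₁ c₂))) ⟨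
    a ^ ((c₁ + c₂) + N) * suc a ^ P * K ∎)
    where
    open ≤-Reasoning
    K = a ^ P₁ * a ^ N₁ * (suc a ^ P₁ * suc a ^ N₁)
    K>0 : 0 < K
    K>0 = *-mono-< (*-mono-< (m^n>0 a P₁) (m^n>0 a N₁)) (*-mono-< (m^n>0 (suc a) P₁) (m^n>0 (suc a) N₁))
    ring₁ : ∀ p₁ p₂ AP SN Ap An Sp Sn → p₁ * p₂ * AP * SN * (Ap * An * (Sp * Sn))
              ≡ p₁ * Ap * Sn * (p₂ * (AP * An) * (SN * Sp))
    ring₁ = solve-∀
    ring₂ : ∀ A₁ A₂ AN AP Ap An Sp Sn SP → A₁ * An * Sp * (A₂ * (AN * Ap) * (SP * Sn))
              ≡ A₁ * A₂ * AN * SP * (Ap * An * (Sp * Sn))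
    ring₂ = solve-∀

  -- Use the first bound at exactly its own exponent σ₁ − a c₁ (as P₁ or as N₁) and the
  -- second at the rest of the given exponent; `combine` multiplies them and cancels K.
  *-bound : ∀ {p₁ σ₁ c₁ p₂ σ₂ c₂} → ProductBound a p₁ σ₁ c₁ → ProductBound a p₂ σ₂ c₂ →
            ProductBound a (p₁ * p₂) (σ₁ + σ₂) (c₁ + c₂)
  *-bound {p₁} {σ₁} {c₁} {p₂} {σ₂} {c₂} bound₁ bound₂ .bound P N σ+N≤ac+P with ≤-total (a * c₁) σ₁
  ... | inj₁ ac₁≤σ₁ = combine p₁ p₂ c₁ c₂ P N (σ₁ ∸ a * c₁) 0 (bound₁ .bound _ 0 first) (bound₂ .bound (P + 0) _ second)
    where
    P₁ = σ₁ ∸ a * c₁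
    ac₁+P₁≡σ₁ : a * c₁ + P₁ ≡ σ₁
    ac₁+P₁≡σ₁ = m+[n∸m]≡n ac₁≤σ₁
    first : σ₁ + 0 ≤ a * c₁ + P₁
    first = ≤-reflexive (trans (+-identityʳ σ₁) (sym ac₁+P₁≡σ₁))
    second : σ₂ + (N + P₁) ≤ a * c₂ + (P + 0)
    second = +-cancelˡ-≤ (a * c₁) _ _ (begin
      a * c₁ + (σ₂ + (N + P₁))  ≡⟨ ring₁ (a * c₁) σ₂ N P₁ ⟩
      a * c₁ + P₁ + σ₂ + N      ≡⟨ cong (λ t → t + σ₂ + N) ac₁+P₁≡σ₁ ⟩
      σ₁ + σ₂ + N               ≤⟨ σ+N≤ac+P ⟩
      a * (c₁ + c₂) + P         ≡⟨ ring₂ a c₁ c₂ P ⟩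
      a * c₁ + (a * c₂ + (P + 0)) ∎)
      where
      open ≤-Reasoning
      ring₁ : ∀ x y z w → x + (y + (z + w)) ≡ x + w + y + z
      ring₁ = solve-∀
      ring₂ : ∀ a x y P → a * (x + y) + P ≡ a * x + (a * y + (P + 0))
      ring₂ = solve-∀
  ... | inj₂ σ₁≤ac₁ = combine p₁ p₂ c₁ c₂ P N 0 (a * c₁ ∸ σ₁) (bound₁ .bound 0 _ first) (bound₂ .bound (P + N₁) (N + 0) second)
    where
    N₁ = a * c₁ ∸ σ₁
    σ₁+N₁≡ac₁ : σ₁ + N₁ ≡ a * c₁
    σ₁+N₁≡ac₁ = m+[n∸m]≡n σ₁≤ac₁
    first : σ₁ + N₁ ≤ a * c₁ + 0
    first = ≤-reflexive (trans σ₁+N₁≡ac₁ (sym (+-identityʳ _)))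
    second : σ₂ + (N + 0) ≤ a * c₂ + (P + N₁)
    second = +-cancelˡ-≤ (σ₁ + N₁) _ _ (begin
      σ₁ + N₁ + (σ₂ + (N + 0))       ≡⟨ ring₁ σ₁ N₁ σ₂ N ⟩
      σ₁ + σ₂ + N + N₁               ≤⟨ +-monoˡ-≤ N₁ σ+N≤ac+P ⟩
      a * (c₁ + c₂) + P + N₁         ≡⟨ ring₂ a c₁ c₂ P N₁ ⟩
      a * c₁ + (a * c₂ + (P + N₁))   ≡⟨ cong (_+ (a * c₂ + (P + N₁))) σ₁+N₁≡ac₁ ⟨
      σ₁ + N₁ + (a * c₂ + (P + N₁))  ∎)
      where
      open ≤-Reasoning
      ring₁ : ∀ x y z w → x + y + (z + (w + 0)) ≡ x + z + w + y
      ring₁ = solve-∀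
      ring₂ : ∀ a x y P n → a * (x + y) + P + n ≡ a * x + (a * y + (P + n))
      ring₂ = solve-∀

  ∏-bound : ∀ {n} {p σ c : Fin n → ℕ} → (∀ i → ProductBound a (p i) (σ i) (c i)) →
            ProductBound a (product p) (sum σ) (sum c)
  ∏-bound {zero}  bounds = one-bound a
  ∏-bound {suc n} bounds = *-bound (bounds zero) (∏-bound (bounds ∘ suc))

-- Partitions and the extremal values Σ_{r,0} and Π_{r,0}

count : ∀ {r m} → Fin r → Vec (Fin r) m → ℕ
count c []      = 0
count c (d ∷ f) = ⟦ ⌊ c ≟F d ⌋ ⟧ + count c f

countOthers : ∀ {r m} → Fin r → Vec (Fin r) m → ℕ
countOthers c []      = 0
countOthers c (d ∷ f) = (if ⌊ c ≟F d ⌋ then 0 else 1) + countOthers c f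

samePartPairs : ∀ {r m} → Vec (Fin r) m → ℕ
samePartPairs []      = 0
samePartPairs (d ∷ f) = count d f + samePartPairs f

choose2 : ℕ → ℕ
choose2 zero    = 0
choose2 (suc m) = m + choose2 m

count+countOthers : ∀ {r m} (c : Fin r) (f : Vec (Fin r) m) → count c f + countOthers c f ≡ m
count+countOthers c []      = refl
count+countOthers c (d ∷ f) with ⌊ c ≟F d ⌋
... | true  = cong suc (count+countOthers c f)
... | false = trans (+-suc (count c f) (countOthers c f)) (cong suc (count+countOthers c f))

2*choose2 : ∀ m → 2 * choose2 (suc m) ≡ suc m * m
2*choose2 zero    = refl
2*choose2 (suc m) = begin
  2 * (suc m + choose2 (suc m))      ≡⟨ *-distribˡ-+ 2 (suc m) (choose2 (suc m)) ⟩
  2 * suc m + 2 * choose2 (suc m)    ≡⟨ cong (2 * suc m +_) (2*choose2 m) ⟩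
  2 * suc m + suc m * m              ≡⟨ ring m ⟩
  suc (suc m) * suc m                ∎
  where
  open ≡-Reasoning
  ring : ∀ m → 2 * suc m + suc m * m ≡ suc (suc m) * suc m
  ring = solve-∀

module _ (a : ℕ) where

  tSum tProd : ∀ {r m} → Vec (Fin r) m → ℕ
  tSum f  = pairSum (λ _ → true) (tWeight a f)
  tProd f = pairProd (tWeight a f)

  tRow : ∀ {r m} → Fin r → Vec (Fin r) m → Fin m → ℕ
  tRow c f j = if ⌊ c ≟F lookup f j ⌋ then a else suc a

  sum-tRow : ∀ {r m} (c : Fin r) (f : Vec (Fin r) m) → sum (tRow c f) + count c f ≡ suc a * m
  sum-tRow c []      = sym (*-zeroʳ (suc a))
  sum-tRow {m = suc m} c (d ∷ f) = begin
    tRow c (d ∷ f) zero + sum (tRow c f) + (⟦ ⌊ c ≟F d ⌋ ⟧ + count c f)  ≡⟨ shuffle ⌊ c ≟F d ⌋ ⟩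
    suc a + (sum (tRow c f) + count c f)                                  ≡⟨ cong (suc a +_) (sum-tRow c f) ⟩
    suc a + suc a * m                                                    ≡⟨ *-suc (suc a) m ⟨
    suc a * suc m                                                        ∎
    where
    open ≡-Reasoning
    shuffle : ∀ t → (if t then a else suc a) + sum (tRow c f) + (⟦ t ⟧ + count c f)
                  ≡ suc a + (sum (tRow c f) + count c f)
    shuffle true  = ring a (sum (tRow c f)) (count c f)
      where ring : ∀ a S C → a + S + (1 + C) ≡ suc a + (S + C)
            ring = solve-∀
    shuffle false = +-assoc (suc a) (sum (tRow c f)) (count c f)

  product-tRow : ∀ {r m} (c : Fin r) (f : Vec (Fin r) m) →
                product (tRow c f) ≡ a ^ count c f * suc a ^ countOthers c f
  product-tRow c []      = refl
  product-tRow c (d ∷ f) with ⌊ c ≟F d ⌋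
  ... | true  = trans (cong (a *_) (product-tRow c f)) (sym (*-assoc a _ _))
  ... | false = trans (cong (suc a *_) (product-tRow c f)) (ring a (a ^ count c f) (suc a ^ countOthers c f))
    where
    ring : ∀ a x y → suc a * (x * y) ≡ x * (suc a * y)
    ring = solve-∀

  tSum+samePartPairs : ∀ {r m} (f : Vec (Fin r) m) → tSum f + samePartPairs f ≡ suc a * choose2 m
  tSum+samePartPairs []      = sym (*-zeroʳ (suc a))
  tSum+samePartPairs {m = suc m} (d ∷ f) = begin
    tSum (d ∷ f) + (count d f + samePartPairs f)
      ≡⟨ cong (_+ (count d f + samePartPairs f)) (pairSum-head (tWeight a (d ∷ f))) ⟩
    sum (tRow d f) + tSum f + (count d f + samePartPairs f)
      ≡⟨ +-interchange (sum (tRow d f)) (tSum f) (count d f) (samePartPairs f) ⟩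
    sum (tRow d f) + count d f + (tSum f + samePartPairs f)
      ≡⟨ cong₂ _+_ (sum-tRow d f) (tSum+samePartPairs f) ⟩
    suc a * m + suc a * choose2 m
      ≡⟨ *-distribˡ-+ (suc a) m (choose2 m) ⟨
    suc a * choose2 (suc m) ∎
    where open ≡-Reasoning

  tProd-cons : ∀ {r m} (d : Fin r) (f : Vec (Fin r) m) →
               tProd (d ∷ f) ≡ a ^ count d f * suc a ^ countOthers d f * tProd f
  tProd-cons d f = trans (pairProd-head (tWeight a (d ∷ f))) (cong (_* tProd f) (product-tRow d f))

tProd>0 : ∀ b {r m} (f : Vec (Fin r) m) → 0 < tProd (suc b) f
tProd>0 b []      = s≤s z≤n
tProd>0 b (d ∷ f) = subst (0 <_) (sym (tProd-cons (suc b) d f))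
  (*-mono-< (*-mono-< (m^n>0 (suc b) (count d f)) (m^n>0 (2+ b) (countOthers d f))) (tProd>0 b f))

sum-count : ∀ {r m} (f : Vec (Fin r) m) → sum (λ c → count c f) ≡ m
sum-count {r} []      = sum-zero {r} (λ _ → refl)
sum-count {r} (d ∷ f) = trans (∑-distrib-+ (λ c → ⟦ ⌊ c ≟F d ⌋ ⟧) (λ c → count c f))
                              (cong₂ _+_ (sum-δ d (λ _ → 1)) (sum-count f))

sum-count² : ∀ {r m} (f : Vec (Fin r) m) → sum (λ c → count c f * count c f) ≡ 2 * samePartPairs f + m
sum-count² {r} []      = sum-zero {r} (λ _ → refl)
sum-count² {r} {suc m} (d ∷ f) = begin
  sum (λ c → (δ c + count c f) * (δ c + count c f))
    ≡⟨ sum-cong-≗ (λ c → square (⌊ c ≟F d ⌋) (count c f)) ⟩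
  sum (λ c → δ c + 2 * (if ⌊ c ≟F d ⌋ then count c f else 0) + count c f * count c f)
    ≡⟨ ∑-distrib-+ (λ c → δ c + 2 * (if ⌊ c ≟F d ⌋ then count c f else 0)) (λ c → count c f * count c f) ⟩
  sum (λ c → δ c + 2 * (if ⌊ c ≟F d ⌋ then count c f else 0)) + sum (λ c → count c f * count c f)
    ≡⟨ cong₂ _+_ (∑-distrib-+ δ (λ c → 2 * (if ⌊ c ≟F d ⌋ then count c f else 0))) (sum-count² f) ⟩
  sum δ + sum (λ c → 2 * (if ⌊ c ≟F d ⌋ then count c f else 0)) + (2 * samePartPairs f + m)
    ≡⟨ cong₂ (λ u v → u + v + (2 * samePartPairs f + m)) (sum-δ d (λ _ → 1))
         (trans (sym (*-distribˡ-sum 2 (λ c → if ⌊ c ≟F d ⌋ then count c f else 0)))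
                (cong (2 *_) (sum-δ d (λ c → count c f)))) ⟩
  1 + 2 * count d f + (2 * samePartPairs f + m)
    ≡⟨ ring (count d f) (samePartPairs f) m ⟩
  2 * (count d f + samePartPairs f) + suc m ∎
  where
  open ≡-Reasoning
  δ : Fin r → ℕ
  δ c = ⟦ ⌊ c ≟F d ⌋ ⟧
  square : ∀ t x → (⟦ t ⟧ + x) * (⟦ t ⟧ + x) ≡ ⟦ t ⟧ + 2 * (if t then x else 0) + x * x
  square true  x = ring′ x
    where ring′ : ∀ x → (1 + x) * (1 + x) ≡ 1 + 2 * x + x * x
          ring′ = solve-∀
  square false x = refl
  ring : ∀ x y m → 1 + 2 * x + (2 * y + m) ≡ 2 * (x + y) + suc m
  ring = solve-∀

module _ {r} (c₀ : Fin r) where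
  private instance
    r≢0 : NonZero r
    r≢0 = nonZeroIndex c₀

  sum-r*count : ∀ {m} (f : Vec (Fin r) m) → sum (λ c → r * count c f) ≡ r * m
  sum-r*count f = trans (sym (*-distribˡ-sum r (λ c → count c f))) (cong (r *_) (sum-count f))

  largest-part : ∀ {m} (f : Vec (Fin r) m) → ∃[ c ] m ≤ r * count c f
  largest-part {m} f with any? (λ c → m ≤? r * count c f)
  ... | yes found = found
  ... | no  none  = ⊥-elim (<⇒≱ (m<n+m (r * m) (>-nonZero⁻¹ r)) (begin
    r + r * m                          ≡⟨ cong₂ _+_ (*-identityʳ r) (sum-r*count f) ⟨
    r * 1 + sum (λ c → r * count c f)  ≡⟨ cong (_+ sum (λ c → r * count c f)) (sum-const r 1) ⟨
    sum {r} (λ _ → 1) + sum (λ c → r * count c f)  ≡⟨ ∑-distrib-+ (λ _ → 1) (λ c → r * count c f) ⟨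
    sum (λ c → suc (r * count c f))    ≤⟨ sum-mono-≤ (λ c → ≰⇒> (λ m≤ → none (c , m≤))) ⟩
    sum {r} (λ _ → m)                  ≡⟨ sum-const r m ⟩
    r * m                              ∎))
    where open ≤-Reasoning

  smallest-part : ∀ {m} (f : Vec (Fin r) m) → ∃[ c ] r * count c f ≤ m
  smallest-part {m} f with any? (λ c → r * count c f ≤? m)
  ... | yes found = found
  ... | no  none  = ⊥-elim (<⇒≱ (*-monoʳ-< r (n<1+n m)) (begin
    r * suc m                       ≡⟨ sum-const r (suc m) ⟨
    sum {r} (λ _ → suc m)           ≤⟨ sum-mono-≤ (λ c → ≰⇒> (λ ≤m → none (c , ≤m))) ⟩
    sum (λ c → r * count c f)       ≡⟨ sum-r*count f ⟩
    r * m                           ∎))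
    where open ≤-Reasoning

remove-from-part : ∀ {r m} (c : Fin r) (f : Vec (Fin r) (suc m)) → 1 ≤ count c f →
  Σ (Vec (Fin r) m) λ f′ → (∀ e → count e f′ + ⟦ ⌊ e ≟F c ⌋ ⟧ ≡ count e f)
                          × (samePartPairs f + 1 ≡ samePartPairs f′ + count c f)
remove-from-part c (d ∷ g) c∈f with c ≟F d
... | yes refl = g , (λ e → +-comm (count e g) _) , ring (count c g) (samePartPairs g)
  where ring : ∀ x y → x + y + 1 ≡ y + (1 + x)
        ring = solve-∀
remove-from-part {m = zero}  c (d ∷ []) () | no _
remove-from-part {m = suc m} c (d ∷ g) c∈g | no c≢d with remove-from-part c g c∈g
... | g′ , counts , pairs = d ∷ g′ , counts′ , pairs′
  where
  counts′ : ∀ e → ⟦ ⌊ e ≟F d ⌋ ⟧ + count e g′ + ⟦ ⌊ e ≟F c ⌋ ⟧ ≡ ⟦ ⌊ e ≟F d ⌋ ⟧ + count e g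
  counts′ e = trans (+-assoc ⟦ ⌊ e ≟F d ⌋ ⟧ (count e g′) ⟦ ⌊ e ≟F c ⌋ ⟧) (cong (⟦ ⌊ e ≟F d ⌋ ⟧ +_) (counts e))
  count-d : count d g′ ≡ count d g
  count-d = trans (sym (trans (cong (λ t → count d g′ + ⟦ t ⟧) (≟-≢ (c≢d ∘ sym))) (+-identityʳ _))) (counts d)
  pairs′ : count d g + samePartPairs g + 1 ≡ count d g′ + samePartPairs g′ + count c g
  pairs′ = begin
    count d g + samePartPairs g + 1      ≡⟨ +-assoc (count d g) _ 1 ⟩
    count d g + (samePartPairs g + 1)    ≡⟨ cong₂ _+_ (sym count-d) pairs ⟩
    count d g′ + (samePartPairs g′ + count c g) ≡⟨ +-assoc (count d g′) _ _ ⟨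
    count d g′ + samePartPairs g′ + count c g ∎
    where open ≡-Reasoning

maxList-ub : ∀ {x} xs → x ∈ xs → x ≤ maxList xs
maxList-ub (y ∷ ys) (here refl) = m≤m⊔n y (maxList ys)
maxList-ub (y ∷ ys) (there x∈ys) = ≤-trans (maxList-ub ys x∈ys) (m≤n⊔m y (maxList ys))

maxList-∈ : ∀ y ys → maxList (y ∷ ys) ∈ y ∷ ys
maxList-∈ y []       = here (⊔-identityʳ y)
maxList-∈ y (z ∷ zs) with ≤-total y (maxList (z ∷ zs))
... | inj₁ y≤max = there (subst (_∈ z ∷ zs) (sym (m≤n⇒m⊔n≡n y≤max)) (maxList-∈ z zs))
... | inj₂ max≤y = here (m≥n⇒m⊔n≡m max≤y)

∈-allAssign : ∀ {r} m (f : Vec (Fin r) m) → f ∈ allAssign r m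
∈-allAssign zero    []      = here refl
∈-allAssign {r} (suc m) (c ∷ f) =
  ∈-concatMap⁺ (λ g → map (_∷ g) (allFin r)) (Any.map (λ { refl → ∈-map⁺ (_∷ f) (∈-allFin c) }) (∈-allAssign m f))

module _ {r m} (g : Vec (Fin r) m → ℕ) where

  maxAssign-ub : ∀ f → g f ≤ maxList (map g (allAssign r m))
  maxAssign-ub f = maxList-ub _ (∈-map⁺ g (∈-allAssign m f))

  maxAssign-attained : Fin r → ∃[ f ] maxList (map g (allAssign r m)) ≡ g f
  maxAssign-attained c₀ with ∈-map⁻ g (nonempty (∈-map⁺ g (∈-allAssign m (replicate m c₀))))
    where
    nonempty : ∀ {x xs} → x ∈ xs → maxList xs ∈ xs
    nonempty {xs = y ∷ ys} _ = maxList-∈ y ys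
  ... | f , _ , max≡gf = f , max≡gf

module _ {r} (a : ℕ) (c₀ : Fin r) where

  -- S is the number of pairs inside parts of an extremal partition; the inequality is
  -- Cauchy–Schwarz for the part sizes.
  Σr0-samePartPairs : ∀ s → ∃[ S ] Σr0 r a s + S ≡ suc a * choose2 s × s * s ≤ r * (2 * S + s)
  Σr0-samePartPairs s with maxAssign-attained (tSum a) c₀
  ... | f , Σ≡ = samePartPairs f , trans (cong (_+ samePartPairs f) Σ≡) (tSum+samePartPairs a f)
               , subst₂ (λ u v → u * u ≤ r * v) (sum-count f) (sum-count² f) (cauchy-schwarz r (λ c → count c f))

  -- Deleting a vertex from a largest part of an extremal partition of s + 1 vertices.
  Σr0-suc : ∀ s → ∃[ t ] suc s ≤ r * t × Σr0 r a (suc s) + t ≤ Σr0 r a s + suc a * s + 1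
  Σr0-suc s with maxAssign-attained (tSum a) c₀
  ... | f , Σ≡ with largest-part c₀ f
  ... | c , s+1≤r*t with remove-from-part c f (count>0 (count c f) s+1≤r*t)
    where
    count>0 : ∀ t → suc s ≤ r * t → 1 ≤ t
    count>0 zero    s+1≤r*0 = ⊥-elim (<⇒≱ z<s (subst (suc s ≤_) (*-zeroʳ r) s+1≤r*0))
    count>0 (suc _) _       = s≤s z≤n
  ... | f′ , _ , pairs = count c f , s+1≤r*t , (begin
    Σr0 r a (suc s) + count c f      ≡⟨ cong (_+ count c f) Σ≡ ⟩
    tSum a f + count c f             ≡⟨ tSum-removed ⟩
    tSum a f′ + suc a * s + 1        ≤⟨ +-monoˡ-≤ 1 (+-monoˡ-≤ (suc a * s) (maxAssign-ub (tSum a) f′)) ⟩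
    Σr0 r a s + suc a * s + 1        ∎)
    where
    open ≤-Reasoning
    tSum-removed : tSum a f + count c f ≡ tSum a f′ + suc a * s + 1
    tSum-removed = +-cancelʳ-≡ (samePartPairs f′) _ _ (begin-equality
      tSum a f + count c f + samePartPairs f′     ≡⟨ ring₁ (tSum a f) (count c f) (samePartPairs f′) ⟩
      tSum a f + (samePartPairs f′ + count c f)   ≡⟨ cong (tSum a f +_) pairs ⟨
      tSum a f + (samePartPairs f + 1)            ≡⟨ +-assoc (tSum a f) _ 1 ⟨
      tSum a f + samePartPairs f + 1              ≡⟨ cong (_+ 1) (tSum+samePartPairs a f) ⟩
      suc a * (s + choose2 s) + 1                 ≡⟨ cong (_+ 1) (*-distribˡ-+ (suc a) s (choose2 s)) ⟩
      suc a * s + suc a * choose2 s + 1           ≡⟨ cong (λ t → suc a * s + t + 1) (tSum+samePartPairs a f′) ⟨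
      suc a * s + (tSum a f′ + samePartPairs f′) + 1 ≡⟨ ring₂ (suc a * s) (tSum a f′) (samePartPairs f′) ⟩
      tSum a f′ + suc a * s + 1 + samePartPairs f′ ∎)
      where
      ring₁ : ∀ x y z → x + y + z ≡ x + (z + y)
      ring₁ = solve-∀
      ring₂ : ∀ x y z → x + (y + z) + 1 ≡ y + x + 1 + z
      ring₂ = solve-∀

  -- Adding a vertex to a smallest part of an extremal partition of n vertices.
  Πr0-suc : ∀ n → ∃₂ λ p q → p + q ≡ n × r * p ≤ n × Πr0 r a n * (a ^ p * suc a ^ q) ≤ Πr0 r a (suc n)
  Πr0-suc n with maxAssign-attained (tProd a) c₀
  ... | f , Π≡ with smallest-part c₀ f
  ... | c , r*p≤n = count c f , countOthers c f , count+countOthers c f , r*p≤n , (begin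
    Πr0 r a n * (a ^ count c f * suc a ^ countOthers c f)  ≡⟨ cong (_* (a ^ count c f * suc a ^ countOthers c f)) Π≡ ⟩
    tProd a f * (a ^ count c f * suc a ^ countOthers c f)  ≡⟨ *-comm (tProd a f) _ ⟩
    a ^ count c f * suc a ^ countOthers c f * tProd a f    ≡⟨ tProd-cons a c f ⟨
    tProd a (c ∷ f)                                        ≤⟨ maxAssign-ub (tProd a) (c ∷ f) ⟩
    Πr0 r a (suc n)                                        ∎)
    where open ≤-Reasoning

Πr0>0 : ∀ r b n → Fin r → 0 < Πr0 r (suc b) n
Πr0>0 r b n c₀ = ≤-trans (tProd>0 b (replicate n c₀)) (maxAssign-ub (tProd (suc b)) (replicate n c₀))

-- Degrees in multigraphs

sum-inside : ∀ {N} (X : Subset N) → sum (λ i → ⟦ lookup X i ⟧) ≡ ∣ X ∣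
sum-inside []          = refl
sum-inside (true  ∷ X) = cong suc (sum-inside X)
sum-inside (false ∷ X) = sum-inside X

∣∣+sum-outside : ∀ {N} (X : Subset N) → ∣ X ∣ + sum (λ i → if lookup X i then 0 else 1) ≡ N
∣∣+sum-outside []          = refl
∣∣+sum-outside (true  ∷ X) = cong suc (∣∣+sum-outside X)
∣∣+sum-outside (false ∷ X) = trans (+-suc ∣ X ∣ _) (cong suc (∣∣+sum-outside X))

∣insert∣ : ∀ {N} (X : Subset N) u → lookup X u ≡ false → ∣ X [ u ]≔ true ∣ ≡ suc ∣ X ∣
∣insert∣ (false ∷ X) zero    _    = refl
∣insert∣ (true  ∷ X) (suc u) u∉X = cong suc (∣insert∣ X u u∉X)
∣insert∣ (false ∷ X) (suc u) u∉X = ∣insert∣ X u u∉X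

lookup-insert : ∀ {N} (X : Subset N) u i → lookup (X [ u ]≔ true) i ≡ (if ⌊ i ≟F u ⌋ then true else lookup X i)
lookup-insert X u i with i ≟F u
... | yes refl = lookup∘update i X true
... | no  i≢u  = lookup∘update′ i≢u X true

module _ {N} (G : Multigraph N) where

  degree : Fin N → ℕ
  degree v = sum λ u → if ⌊ u ≟F v ⌋ then 0 else w G u v

  degreeInto : Subset N → Fin N → ℕ
  degreeInto X u = sum λ v → if lookup X v then w G u v else 0

  doubled : Subset N → Fin N → Fin N → ℕ
  doubled X i j = if lookup X i then (if lookup X j then (if ⌊ i ≟F j ⌋ then 0 else w G i j) else 0) else 0

  private
    upper : Subset N → Fin N → Fin N → ℕ
    upper X i j = if lookup X i ∧ lookup X j ∧ (toℕ i <ᵇ toℕ j) then w G i j else 0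

    upper-both-ways : ∀ i j → (if toℕ i <ᵇ toℕ j then w G i j else 0) + (if toℕ j <ᵇ toℕ i then w G j i else 0)
                              ≡ (if ⌊ i ≟F j ⌋ then 0 else w G i j)
    upper-both-ways i j with toℕ i <ᵇ toℕ j | <ᵇ-reflects-< (toℕ i) (toℕ j)
                           | toℕ j <ᵇ toℕ i | <ᵇ-reflects-< (toℕ j) (toℕ i)
    ... | true  | ofʸ i<j | true  | ofʸ j<i = ⊥-elim (<-asym i<j j<i)
    ... | true  | ofʸ i<j | false | _       = trans (+-identityʳ _) (sym (cong (if_then 0 else w G i j)
      (≟-≢ (λ i≡j → <-irrefl (cong toℕ i≡j) i<j))))
    ... | false | _       | true  | ofʸ j<i = trans (Multigraph.sym G j i) (sym (cong (if_then 0 else w G i j)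
      (≟-≢ (λ i≡j → <-irrefl (cong toℕ (sym i≡j)) j<i))))
    ... | false | ofⁿ i≮j | false | ofⁿ j≮i = sym (cong (if_then 0 else w G i j) (trans (cong (⌊_⌋ ∘ (i ≟F_)) (sym i≡j)) (≟-refl i)))
      where
      i≡j : i ≡ j
      i≡j = toℕ-injective (≤-antisym (≮⇒≥ j≮i) (≮⇒≥ i≮j))

    upper+upperᵀ : ∀ X i j → upper X i j + upper X j i ≡ doubled X i j
    upper+upperᵀ X i j with lookup X i | lookup X j
    ... | true  | true  = upper-both-ways i j
    ... | true  | false = refl
    ... | false | true  = refl
    ... | false | false = refl

  2*eSub : ∀ X → 2 * eSub G X ≡ sum λ i → sum λ j → doubled X i j
  2*eSub X = begin
    2 * eSub G X                                      ≡⟨ cong (eSub G X +_) (+-identityʳ _) ⟩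
    eSub G X + eSub G X                               ≡⟨ cong₂ _+_ (pairSum≡∑∑ (lookup X) (w G)) (pairSum≡∑∑ (lookup X) (w G)) ⟩
    Σupper + Σupper                                   ≡⟨ cong (Σupper +_) (∑-comm (upper X)) ⟩
    Σupper + (sum λ i → sum λ j → upper X j i)        ≡⟨ ∑-distrib-+ (λ i → sum (upper X i)) _ ⟨
    (sum λ i → sum (upper X i) + sum λ j → upper X j i) ≡⟨ sum-cong-≗ (λ i → ∑-distrib-+ (upper X i) _) ⟨
    (sum λ i → sum λ j → upper X i j + upper X j i)   ≡⟨ sum-cong-≗ (λ i → sum-cong-≗ (upper+upperᵀ X i)) ⟩
    (sum λ i → sum λ j → doubled X i j)               ∎
    where
    open ≡-Reasoning
    Σupper = sum λ i → sum (upper X i)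

  degreeSum : Subset N → ℕ
  degreeSum X = sum λ v → if lookup X v then degree v else 0

  private
    split-degree : ∀ X v u → (if lookup X v then (if ⌊ u ≟F v ⌋ then 0 else w G u v) else 0)
                           ≡ doubled X v u + (if lookup X v then (if lookup X u then 0 else w G u v) else 0)
    split-degree X v u with lookup X v in v∈X | lookup X u in u∈X
    ... | false | _     = refl
    ... | true  | true  = trans (cong₂ (if_then 0 else_) (≟-sym u v) (Multigraph.sym G u v)) (sym (+-identityʳ _))
    ... | true  | false = cong (if_then 0 else w G u v) (≟-≢ u≢v)
      where
      u≢v : u ≢ v
      u≢v refl with () ← trans (sym v∈X) u∈X

    edges-leaving : ∀ X u → (sum λ v → if lookup X v then (if lookup X u then 0 else w G u v) else 0)
                          ≡ (if lookup X u then 0 else degreeInto X u)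
    edges-leaving X u with lookup X u
    ... | true  = sum-zero {N} λ v → if-same (lookup X v)
      where if-same : ∀ b → (if b then 0 else 0) ≡ 0
            if-same true  = refl
            if-same false = refl
    ... | false = refl

  degreeSum≡ : ∀ X → degreeSum X ≡ 2 * eSub G X + sum λ u → if lookup X u then 0 else degreeInto X u
  degreeSum≡ X = begin
    degreeSum X
      ≡⟨ sum-cong-≗ (λ v → if-sum (lookup X v) (λ u → if ⌊ u ≟F v ⌋ then 0 else w G u v)) ⟩
    (sum λ v → sum λ u → if lookup X v then (if ⌊ u ≟F v ⌋ then 0 else w G u v) else 0)
      ≡⟨ sum-cong-≗ (λ v → sum-cong-≗ (split-degree X v)) ⟩
    (sum λ v → sum λ u → doubled X v u + leaving v u)
      ≡⟨ sum-cong-≗ (λ v → ∑-distrib-+ (doubled X v) (leaving v)) ⟩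
    (sum λ v → sum (doubled X v) + sum (leaving v))
      ≡⟨ ∑-distrib-+ (λ v → sum (doubled X v)) (λ v → sum (leaving v)) ⟩
    (sum λ v → sum (doubled X v)) + (sum λ v → sum (leaving v))
      ≡⟨ cong₂ _+_ (sym (2*eSub X)) (∑-comm leaving) ⟩
    2 * eSub G X + (sum λ u → sum λ v → leaving v u)
      ≡⟨ cong (2 * eSub G X +_) (sum-cong-≗ (edges-leaving X)) ⟩
    2 * eSub G X + (sum λ u → if lookup X u then 0 else degreeInto X u) ∎
    where
    open ≡-Reasoning
    leaving : Fin N → Fin N → ℕ
    leaving v u = if lookup X v then (if lookup X u then 0 else w G u v) else 0

  private
    doubled-insert : ∀ X u → lookup X u ≡ false → ∀ i j →
      doubled (X [ u ]≔ true) i j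
        ≡ doubled X i j + ((if ⌊ i ≟F u ⌋ then (if lookup X j then w G i j else 0) else 0)
                         + (if ⌊ j ≟F u ⌋ then (if lookup X i then w G i j else 0) else 0))
    doubled-insert X u u∉X i j
      rewrite lookup-insert X u i | lookup-insert X u j with i ≟F u | j ≟F u
    ... | yes refl | yes refl rewrite u∉X | ≟-refl i = refl
    ... | yes refl | no j≢u rewrite u∉X | ≟-≢ (j≢u ∘ sym) with lookup X j
    ...   | true  = sym (+-identityʳ _)
    ...   | false = refl
    doubled-insert X u u∉X i j | no i≢u | yes refl rewrite u∉X | ≟-≢ i≢u with lookup X i
    ...   | true  = refl
    ...   | false = refl
    doubled-insert X u u∉X i j | no _ | no _ = sym (+-identityʳ _)

  eSub-insert : ∀ X u → lookup X u ≡ false → eSub G (X [ u ]≔ true) ≡ eSub G X + degreeInto X u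
  eSub-insert X u u∉X = *-cancelˡ-≡ _ _ 2 (begin
    2 * eSub G (X [ u ]≔ true)
      ≡⟨ 2*eSub (X [ u ]≔ true) ⟩
    (sum λ i → sum λ j → doubled (X [ u ]≔ true) i j)
      ≡⟨ sum-cong-≗ (λ i → sum-cong-≗ (doubled-insert X u u∉X i)) ⟩
    (sum λ i → sum λ j → doubled X i j + (row i j + column i j))
      ≡⟨ sum-cong-≗ (λ i → ∑-distrib-+ (doubled X i) _) ⟩
    (sum λ i → sum (doubled X i) + sum λ j → row i j + column i j)
      ≡⟨ ∑-distrib-+ (λ i → sum (doubled X i)) _ ⟩
    (sum λ i → sum (doubled X i)) + (sum λ i → sum λ j → row i j + column i j)
      ≡⟨ cong₂ _+_ (sym (2*eSub X)) (trans (sum-cong-≗ (λ i → ∑-distrib-+ (row i) (column i)))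
                                          (∑-distrib-+ (λ i → sum (row i)) (λ i → sum (column i)))) ⟩
    2 * eSub G X + ((sum λ i → sum (row i)) + (sum λ i → sum (column i)))
      ≡⟨ cong (λ t → 2 * eSub G X + t) (cong₂ _+_ Σrow Σcolumn) ⟩
    2 * eSub G X + (degreeInto X u + degreeInto X u)
      ≡⟨ ring (eSub G X) (degreeInto X u) ⟩
    2 * (eSub G X + degreeInto X u) ∎)
    where
    open ≡-Reasoning
    row column : Fin N → Fin N → ℕ
    row i j    = if ⌊ i ≟F u ⌋ then (if lookup X j then w G i j else 0) else 0
    column i j = if ⌊ j ≟F u ⌋ then (if lookup X i then w G i j else 0) else 0
    Σrow : (sum λ i → sum (row i)) ≡ degreeInto X u
    Σrow = trans (sum-cong-≗ (λ i → sym (if-sum ⌊ i ≟F u ⌋ (λ j → if lookup X j then w G i j else 0))))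
                 (sum-δ u (λ i → sum λ j → if lookup X j then w G i j else 0))
    Σcolumn : (sum λ i → sum (column i)) ≡ degreeInto X u
    Σcolumn = trans (sum-cong-≗ (λ i → sum-δ u (λ j → if lookup X i then w G i j else 0)))
                    (sum-cong-≗ (λ i → cong (if lookup X i then_else 0) (Multigraph.sym G i u)))
    ring : ∀ x y → 2 * x + (y + y) ≡ 2 * (x + y)
    ring = solve-∀

sum-others : ∀ {n} (v : Fin (suc n)) → sum (λ u → if ⌊ u ≟F v ⌋ then 0 else 1) ≡ n
sum-others {n}     zero    = trans (sum-const n 1) (*-identityʳ n)
sum-others {suc n} (suc v) =
  cong suc (trans (sum-cong-≗ (λ u → cong (if_then 0 else 1) (≟-suc u v))) (sum-others v))

module _ (b : ℕ) {n} (G : Multigraph (suc n)) where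
  private
    a = suc b

  pdeg-bound : ∀ v → ProductBound a (pdeg G v) (degree G v) n
  pdeg-bound v = subst₂ (λ p c → ProductBound a p (degree G v) c)
    (sym (product-allFin (λ u → if ⌊ u ≟F v ⌋ then 1 else w G u v))) (sum-others v)
    (∏-bound b λ u → factor ⌊ u ≟F v ⌋ (w G u v))
    where
    factor : ∀ t x → ProductBound a (if t then 1 else x) (if t then 0 else x) (if t then 0 else 1)
    factor true  x = one-bound a
    factor false x = single-bound a x

  pdegProduct : Subset (suc n) → ℕ
  pdegProduct X = product λ v → if lookup X v then pdeg G v else 1

  pdegProduct-bound : ∀ X → ProductBound a (pdegProduct X) (degreeSum G X) (n * ∣ X ∣)
  pdegProduct-bound X = subst (ProductBound a (pdegProduct X) (degreeSum G X)) vertices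
    (∏-bound b λ v → factor (lookup X v) v)
    where
    factor : ∀ t v → ProductBound a (if t then pdeg G v else 1) (if t then degree G v else 0) (if t then n else 0)
    factor true  v = pdeg-bound v
    factor false v = one-bound a
    n*⟦_⟧ : ∀ t → (if t then n else 0) ≡ n * ⟦ t ⟧
    n*⟦ true  ⟧ = sym (*-identityʳ n)
    n*⟦ false ⟧ = sym (*-zeroʳ n)
    vertices : (sum λ v → if lookup X v then n else 0) ≡ n * ∣ X ∣
    vertices = trans (sum-cong-≗ (λ v → n*⟦ lookup X v ⟧))
                     (trans (sym (*-distribˡ-sum n (λ v → ⟦ lookup X v ⟧))) (cong (n *_) (sum-inside X)))

-- The exponent arithmetic

-- For an s-set X with s = 1 + s₁: E = e(G[X]), D = number of edges leaving X, m = number of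
-- outside vertices, Σs = Σ_{r,0}(a,s), Σ₁ = Σ_{r,0}(a,s+1), C = choose2 s.
degree-budget : ∀ a E Σs Σ₁ S t D m C s₁ → 2 ≤ m → E * m + D ≤ Σ₁ * m →
  Σ₁ + t ≤ Σs + suc a * suc s₁ + 1 → suc Σs ≤ E → Σs + S ≡ suc a * C → 2 * C ≡ suc s₁ * s₁ →
  2 * E + D + (2 * S + m * t) ≤ a * ((s₁ + m) * suc s₁) + (suc s₁ * s₁ + 2 + m * suc s₁)
degree-budget a E Σs Σ₁ S t D (suc zero) C s₁ (s≤s ()) _ _ _ _ _
degree-budget a E Σs Σ₁ S t D (suc (suc m₂)) C s₁ _ Em+D≤Σ₁m Σ₁+t≤ Σs<E Σs+S≡ 2C≡ =
  +-cancelʳ-≤ K _ _ (begin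
    2 * E + D + (2 * S + m * t) + K                          ≡⟨ ring₁ E D S m₂ t Σs ⟩
    E * m + D + t * m + suc Σs * m₂ + 2 * (Σs + S)          ≤⟨ +-monoˡ-≤ (2 * (Σs + S))
                                                                (+-mono-≤ (+-monoˡ-≤ (t * m) Em+D≤Σ₁m) (*-monoˡ-≤ m₂ Σs<E)) ⟩
    Σ₁ * m + t * m + E * m₂ + 2 * (Σs + S)                  ≡⟨ cong (λ z → Σ₁ * m + t * m + E * m₂ + 2 * z) Σs+S≡ ⟩
    Σ₁ * m + t * m + E * m₂ + 2 * (suc a * C)               ≡⟨ ring₂ Σ₁ t m E m₂ (suc a) C ⟩
    (Σ₁ + t) * m + E * m₂ + suc a * (2 * C)                 ≤⟨ +-monoˡ-≤ (suc a * (2 * C)) (+-monoˡ-≤ (E * m₂) (*-monoˡ-≤ m Σ₁+t≤)) ⟩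
    (Σs + suc a * suc s₁ + 1) * m + E * m₂ + suc a * (2 * C) ≡⟨ cong (λ z → (Σs + suc a * suc s₁ + 1) * m + E * m₂ + suc a * z) 2C≡ ⟩
    (Σs + suc a * suc s₁ + 1) * m + E * m₂ + suc a * (suc s₁ * s₁) ≡⟨ ring₃ Σs a s₁ m₂ E ⟩
    a * ((s₁ + m) * suc s₁) + (suc s₁ * s₁ + 2 + m * suc s₁) + K ∎)
  where
  open ≤-Reasoning
  m = suc (suc m₂)
  K = E * m₂ + suc Σs * m₂ + 2 * Σs
  ring₁ : ∀ E D S m₂ t Σs → 2 * E + D + (2 * S + suc (suc m₂) * t) + (E * m₂ + suc Σs * m₂ + 2 * Σs)
          ≡ E * suc (suc m₂) + D + t * suc (suc m₂) + suc Σs * m₂ + 2 * (Σs + S)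
  ring₁ = solve-∀
  ring₂ : ∀ Σ₁ t m E m₂ sa C → Σ₁ * m + t * m + E * m₂ + 2 * (sa * C) ≡ (Σ₁ + t) * m + E * m₂ + sa * (2 * C)
  ring₂ = solve-∀
  ring₃ : ∀ Σs a s₁ m₂ E → (Σs + suc a * suc s₁ + 1) * suc (suc m₂) + E * m₂ + suc a * (suc s₁ * s₁)
          ≡ a * ((s₁ + suc (suc m₂)) * suc s₁) + (suc s₁ * s₁ + 2 + suc (suc m₂) * suc s₁) + (E * m₂ + suc Σs * m₂ + 2 * Σs)
  ring₃ = solve-∀

-- The slack in s² ≤ r (2S + s) and s + 1 ≤ r t is x and y; the inequality then becomes
-- an identity with one unit to spare.
exponent-gap : ∀ r s₁ n k m p S t → k + r * (suc s₁ + 2) ≡ n → s₁ + m ≡ n → r * p ≤ n →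
  suc s₁ * suc s₁ ≤ r * (2 * S + suc s₁) → suc (suc s₁) ≤ r * t →
  (k + p * (r * suc s₁)) * suc s₁ + (suc s₁ * s₁ + 2 + m * suc s₁) * (r * suc s₁)
    < (n * suc s₁ + (2 * S + m * t)) * (r * suc s₁)
exponent-gap r s₁ n k m p S t k+r[s+2]≡n s₁+m≡n rp≤n s²≤ s+1≤rt =
  subst₂ _<_ (ring₁ k p r s₁ P) (ring₂ n s₁ Nn r) (*-monoʳ-< s inner)
  where
  s = suc s₁
  P = s * s₁ + 2 + m * s
  Nn = 2 * S + m * t
  x = r * (2 * S + s) ∸ s * s
  y = r * t ∸ suc s
  s²+x≡ : s * s + x ≡ r * (2 * S + s)
  s²+x≡ = m+[n∸m]≡n s²≤
  s+1+y≡ : suc s + y ≡ r * t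
  s+1+y≡ = m+[n∸m]≡n s+1≤rt
  Z = r * (s + 2) + s * s + m * suc s
  ring₁ : ∀ k p r s₁ P → suc s₁ * (k + r * p * suc s₁ + r * P) ≡ (k + p * (r * suc s₁)) * suc s₁ + P * (r * suc s₁)
  ring₁ = solve-∀
  ring₂ : ∀ n s₁ Nn r → suc s₁ * (r * (n * suc s₁) + r * Nn) ≡ (n * suc s₁ + Nn) * (r * suc s₁)
  ring₂ = solve-∀
  ring₃ : ∀ k n s₁ r P x m y → k + n * suc s₁ + r * P + (1 + x + m * y) + (r * (suc s₁ + 2) + suc s₁ * suc s₁ + m * suc (suc s₁))
          ≡ (k + r * (suc s₁ + 2)) + n * suc s₁ + r * P + (suc s₁ * suc s₁ + x) + 1 + m * (suc (suc s₁) + y)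
  ring₃ = solve-∀
  ring₄ : ∀ s₁ m r S t → (s₁ + m) + (s₁ + m) * suc s₁ + r * (suc s₁ * s₁ + 2 + m * suc s₁) + r * (2 * S + suc s₁) + 1 + m * (r * t)
          ≡ r * ((s₁ + m) * suc s₁) + r * (2 * S + m * t) + (r * (suc s₁ + 2) + suc s₁ * suc s₁ + m * suc (suc s₁))
  ring₄ = solve-∀
  balance : k + n * s + r * P + (1 + x + m * y) ≡ r * (n * s) + r * Nn
  balance = +-cancelʳ-≡ Z _ _ (begin-equality
    k + n * s + r * P + (1 + x + m * y) + Z
      ≡⟨ ring₃ k n s₁ r P x m y ⟩
    (k + r * (s + 2)) + n * s + r * P + (s * s + x) + 1 + m * (suc s + y)
      ≡⟨ cong₂ (λ u v → u + n * s + r * P + v + 1 + m * (suc s + y)) k+r[s+2]≡n s²+x≡ ⟩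
    n + n * s + r * P + r * (2 * S + s) + 1 + m * (suc s + y)
      ≡⟨ cong (λ u → n + n * s + r * P + r * (2 * S + s) + 1 + m * u) s+1+y≡ ⟩
    n + n * s + r * P + r * (2 * S + s) + 1 + m * (r * t)
      ≡⟨ cong (λ u → u + u * s + r * P + r * (2 * S + s) + 1 + m * (r * t)) s₁+m≡n ⟨
    (s₁ + m) + (s₁ + m) * s + r * P + r * (2 * S + s) + 1 + m * (r * t)
      ≡⟨ ring₄ s₁ m r S t ⟩
    r * ((s₁ + m) * s) + r * Nn + Z
      ≡⟨ cong (λ u → r * (u * s) + r * Nn + Z) s₁+m≡n ⟩
    r * (n * s) + r * Nn + Z ∎)
    where open ≤-Reasoning
  inner : k + r * p * s + r * P < r * (n * s) + r * Nn
  inner = begin-strict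
    k + r * p * s + r * P                ≤⟨ +-monoˡ-≤ (r * P) (+-monoʳ-≤ k (*-monoˡ-≤ s rp≤n)) ⟩
    k + n * s + r * P                    <⟨ m<m+n (k + n * s + r * P) z<s ⟩
    k + n * s + r * P + (1 + x + m * y)  ≡⟨ balance ⟩
    r * (n * s) + r * Nn                 ∎
    where open ≤-Reasoning

exponent-balance : ∀ r s k n p q P Nn → p + q ≡ n →
  (k + p * (r * s)) * s + P * (r * s) + (q * (r * s) * s + Nn * (r * s))
    ≡ (n * s + Nn) * (r * s) + (P * (r * s) + k * s)
exponent-balance r s k n p q P Nn p+q≡n =
  trans (ring r s k p q P Nn) (cong (λ u → (u * s + Nn) * (r * s) + (P * (r * s) + k * s)) p+q≡n)
  where
  ring : ∀ r s k p q P Nn → (k + p * (r * s)) * s + P * (r * s) + (q * (r * s) * s + Nn * (r * s))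
                          ≡ ((p + q) * s + Nn) * (r * s) + (P * (r * s) + k * s)
  ring = solve-∀

mixed-powers-< : ∀ b X₁ Y₁ X₂ Y₂ → X₁ + Y₁ ≡ X₂ + Y₂ → X₁ < X₂ →
                 suc b ^ X₂ * 2+ b ^ Y₂ < suc b ^ X₁ * 2+ b ^ Y₁
mixed-powers-< b X₁ Y₁ X₂ Y₂ balanced X₁<X₂ with m≤n⇒∃[o]m+o≡n (<⇒≤ X₁<X₂)
... | e , refl = subst₂ _<_ (sym lhs) (sym rhs) (*-monoʳ-< K (^-monoˡ-< e (n<1+n a)))
  where
  instance
    e≢0 : NonZero e
    e≢0 = >-nonZero (+-cancelˡ-< X₁ 0 e (subst (_< X₁ + e) (sym (+-identityʳ X₁)) X₁<X₂))
  a = suc b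
  Y₁≡Y₂+e : Y₁ ≡ Y₂ + e
  Y₁≡Y₂+e = +-cancelˡ-≡ X₁ _ _ (trans balanced (ring X₁ e Y₂))
    where ring : ∀ x e y → x + e + y ≡ x + (y + e)
          ring = solve-∀
  K = a ^ X₁ * suc a ^ Y₂
  instance
    K≢0 : NonZero K
    K≢0 = >-nonZero (*-mono-< (m^n>0 a X₁) (m^n>0 (suc a) Y₂))
  lhs : a ^ (X₁ + e) * suc a ^ Y₂ ≡ K * a ^ e
  lhs = trans (cong (_* suc a ^ Y₂) (^-distribˡ-+-* a X₁ e)) (ring (a ^ X₁) (a ^ e) (suc a ^ Y₂))
    where ring : ∀ x y z → x * y * z ≡ x * z * y
          ring = solve-∀
  rhs : a ^ X₁ * suc a ^ Y₁ ≡ K * suc a ^ e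
  rhs = trans (cong (λ t → a ^ X₁ * suc a ^ t) Y₁≡Y₂+e)
              (trans (cong (a ^ X₁ *_) (^-distribˡ-+-* (suc a) Y₂ e)) (sym (*-assoc (a ^ X₁) _ _)))

module DenseSet (r′ s₁ b n : ℕ) (G : Multigraph (suc n))
                (n-large : suc r′ * (suc s₁ + 2) ≤ n)
                (sparse : InF G (2+ s₁) (Σr0 (suc r′) (suc b) (2+ s₁)))
                (X : Subset (suc n)) (∣X∣≡s : ∣ X ∣ ≡ suc s₁)
                (dense : Σr0 (suc r′) (suc b) (suc s₁) < eSub G X) where
  private
    r = suc r′
    s = suc s₁
    a = suc b
    k = n ∸ r * (s + 2)
    rs = r * s
    E = eSub G X
    m = sum λ u → if lookup X u then 0 else 1
    D = sum λ u → if lookup X u then 0 else degreeInto G X u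

  s₁+m≡n : s₁ + m ≡ n
  s₁+m≡n = suc-injective (trans (cong (_+ m) (sym ∣X∣≡s)) (∣∣+sum-outside X))

  2≤m : 2 ≤ m
  2≤m = +-cancelˡ-≤ s₁ 2 m (begin
    s₁ + 2             ≤⟨ +-monoˡ-≤ 2 (n≤1+n s₁) ⟩
    s + 2              ≤⟨ m≤m+n (s + 2) (r′ * (s + 2)) ⟩
    r * (s + 2)        ≤⟨ n-large ⟩
    n                  ≡⟨ s₁+m≡n ⟨
    s₁ + m             ∎)
    where open ≤-Reasoning

  -- Each outside vertex u together with X spans s + 1 vertices.
  edges-to-outside : E * m + D ≤ Σr0 r a (suc s) * m
  edges-to-outside = sum-upper-bound (lookup X) (degreeInto G X) E (Σr0 r a (suc s)) λ u u∉X →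
    subst (_≤ Σr0 r a (suc s)) (eSub-insert G X u u∉X)
          (sparse (X [ u ]≔ true) (trans (∣insert∣ X u u∉X) (cong suc ∣X∣≡s)))

  module _ (p q : ℕ) (p+q≡n : p + q ≡ n) (rp≤n : r * p ≤ n)
           (Π-step : Πr0 r a n * (a ^ p * suc a ^ q) ≤ Πr0 r a (suc n))
           (S : ℕ) (Σ+S≡ : Σr0 r a s + S ≡ suc a * choose2 s) (s²≤ : s * s ≤ r * (2 * S + s))
           (t : ℕ) (s+1≤rt : suc s ≤ r * t) (Σ-step : Σr0 r a (suc s) + t ≤ Σr0 r a s + suc a * s + 1)
           (pdeg-large : ∀ v → a ^ k * Πr0 r a (suc n) ^ rs ≤ pdeg G v ^ rs * suc a ^ k * Πr0 r a n ^ rs) where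
    private
      A = a ^ k * (a ^ p * suc a ^ q) ^ rs
      Q = pdegProduct b G X
      P = s * s₁ + 2 + m * s
      Nn = 2 * S + m * t

    pdeg-lower : ∀ v → A ≤ pdeg G v ^ rs * suc a ^ k
    pdeg-lower v = *-cancelʳ-≤ A _ (Πr0 r a n ^ rs) {{m^n≢0 _ rs {{>-nonZero (Πr0>0 r b n zero)}}}} (begin
      A * Πr0 r a n ^ rs                                 ≡⟨ ring (a ^ k) ((a ^ p * suc a ^ q) ^ rs) (Πr0 r a n ^ rs) ⟩
      a ^ k * (Πr0 r a n ^ rs * (a ^ p * suc a ^ q) ^ rs) ≡⟨ cong (a ^ k *_) (^-distrib-* (Πr0 r a n) _ rs) ⟨
      a ^ k * (Πr0 r a n * (a ^ p * suc a ^ q)) ^ rs      ≤⟨ *-monoʳ-≤ (a ^ k) (^-monoˡ-≤ rs Π-step) ⟩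
      a ^ k * Πr0 r a (suc n) ^ rs                       ≤⟨ pdeg-large v ⟩
      pdeg G v ^ rs * suc a ^ k * Πr0 r a n ^ rs         ∎)
      where
      open ≤-Reasoning
      ring : ∀ x y z → x * y * z ≡ x * (z * y)
      ring = solve-∀

    pdegProduct-lower : A ^ s ≤ Q ^ rs * (suc a ^ k) ^ s
    pdegProduct-lower = subst₂ (λ u v → A ^ u ≤ v * (suc a ^ k) ^ u) (trans (sum-inside X) ∣X∣≡s)
      (trans (product-cong-≗ (λ v → if-^ (lookup X v) (pdeg G v))) (product-^ rs (λ v → if lookup X v then pdeg G v else 1)))
      (product-lower-bound (lookup X) (λ v → pdeg G v ^ rs) A (suc a ^ k) (λ v _ → pdeg-lower v))
      where
      if-^ : ∀ t x → (if t then x ^ rs else 1) ≡ (if t then x else 1) ^ rs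
      if-^ true  x = refl
      if-^ false x = sym (^-zeroˡ rs)

    pdegProduct-upper : Q * a ^ P * suc a ^ Nn ≤ a ^ (n * s + Nn) * suc a ^ P
    pdegProduct-upper = subst (λ u → Q * a ^ P * suc a ^ Nn ≤ a ^ (n * u + Nn) * suc a ^ P) ∣X∣≡s
      (pdegProduct-bound b G X .bound P Nn (subst₂ _≤_
        (cong (_+ Nn) (sym (degreeSum≡ G X))) (cong (λ u → a * u + P) (cong₂ _*_ s₁+m≡n (sym ∣X∣≡s)))
        (degree-budget a E (Σr0 r a s) (Σr0 r a (suc s)) S t D m (choose2 s) s₁ 2≤m
                       edges-to-outside Σ-step dense Σ+S≡ (2*choose2 s₁))))

    A^s : A ^ s ≡ a ^ ((k + p * rs) * s) * suc a ^ (q * rs * s)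
    A^s = begin
      (a ^ k * (a ^ p * suc a ^ q) ^ rs) ^ s             ≡⟨ cong (λ u → (a ^ k * u) ^ s) (powers-^ a (suc a) p q rs) ⟩
      (a ^ k * (a ^ (p * rs) * suc a ^ (q * rs))) ^ s    ≡⟨ cong (_^ s) (*-assoc (a ^ k) _ _) ⟨
      (a ^ k * a ^ (p * rs) * suc a ^ (q * rs)) ^ s      ≡⟨ cong (λ u → (u * suc a ^ (q * rs)) ^ s) (^-distribˡ-+-* a k (p * rs)) ⟨
      (a ^ (k + p * rs) * suc a ^ (q * rs)) ^ s          ≡⟨ powers-^ a (suc a) (k + p * rs) (q * rs) s ⟩
      a ^ ((k + p * rs) * s) * suc a ^ (q * rs * s)      ∎
      where open ≡-Reasoning

    impossible : ⊥
    impossible = <⇒≱ (mixed-powers-< b X₁ Y₁ X₂ Y₂ (exponent-balance r s k n p q P Nn p+q≡n)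
                   (exponent-gap r s₁ n k m p S t (m∸n+n≡m n-large) s₁+m≡n rp≤n s²≤ s+1≤rt)) (begin
      a ^ X₁ * suc a ^ Y₁
        ≡⟨ powers-* a (suc a) ((k + p * rs) * s) (q * rs * s) (P * rs) (Nn * rs) ⟨
      a ^ ((k + p * rs) * s) * suc a ^ (q * rs * s) * (a ^ (P * rs) * suc a ^ (Nn * rs))
        ≡⟨ cong₂ _*_ A^s (powers-^ a (suc a) P Nn rs) ⟨
      A ^ s * (a ^ P * suc a ^ Nn) ^ rs
        ≤⟨ *-monoˡ-≤ _ pdegProduct-lower ⟩
      Q ^ rs * (suc a ^ k) ^ s * (a ^ P * suc a ^ Nn) ^ rs
        ≡⟨ powers-regroup rs Q ((suc a ^ k) ^ s) (a ^ P) (suc a ^ Nn) ⟩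
      (Q * a ^ P * suc a ^ Nn) ^ rs * (suc a ^ k) ^ s
        ≤⟨ *-monoˡ-≤ ((suc a ^ k) ^ s) (^-monoˡ-≤ rs pdegProduct-upper) ⟩
      (a ^ (n * s + Nn) * suc a ^ P) ^ rs * (suc a ^ k) ^ s
        ≡⟨ cong₂ _*_ (powers-^ a (suc a) (n * s + Nn) P rs) (^-*-assoc (suc a) k s) ⟩
      a ^ X₂ * suc a ^ (P * rs) * suc a ^ (k * s)
        ≡⟨ trans (*-assoc (a ^ X₂) _ _) (cong (a ^ X₂ *_) (sym (^-distribˡ-+-* (suc a) (P * rs) (k * s)))) ⟩
      a ^ X₂ * suc a ^ Y₂ ∎)
      where
      open ≤-Reasoning
      X₁ = (k + p * rs) * s + P * rs
      Y₁ = q * rs * s + Nn * rs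
      X₂ = (n * s + Nn) * rs
      Y₂ = P * rs + k * s

  no-large-pdeg : ¬ (∀ v → a ^ k * Πr0 r a (suc n) ^ rs ≤ pdeg G v ^ rs * suc a ^ k * Πr0 r a n ^ rs)
  no-large-pdeg pdeg-large =
    let p , q , p+q≡n , rp≤n , Π-step = Πr0-suc {r} a zero n
        S , Σ+S≡ , s²≤               = Σr0-samePartPairs {r} a zero s
        t , s+1≤rt , Σ-step          = Σr0-suc {r} a zero s
    in  impossible p q p+q≡n rp≤n Π-step S Σ+S≡ s²≤ t s+1≤rt Σ-step pdeg-large

lemma8p1 : (r s a n : ℕ) → 2 ≤ r → 2 ≤ s → 1 ≤ a → r * (s + 2) ≤ n →
    (G : Multigraph (suc n)) →
    InF G (suc s) (Σr0 r a (suc s)) →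
    InF G s (Σr0 r a s)
    ⊎ (∃[ v ] (pdeg G v ^ (r * s)) * ((suc a) ^ (n ∸ r * (s + 2))) * (Πr0 r a n ^ (r * s))
               < (a ^ (n ∸ r * (s + 2))) * (Πr0 r a (suc n) ^ (r * s)))
lemma8p1 r@(suc r′) s@(suc s₁) a@(suc b) n (s≤s _) (s≤s _) (s≤s _) n-large G sparse
  with any? (λ v → pdeg G v ^ (r * s) * suc a ^ (n ∸ r * (s + 2)) * Πr0 r a n ^ (r * s)
                    <? a ^ (n ∸ r * (s + 2)) * Πr0 r a (suc n) ^ (r * s))
... | yes small = inj₂ small
... | no ¬small = inj₁ λ X ∣X∣≡s → decidable-stable (eSub G X ≤? Σr0 r a s) λ X-dense →
  DenseSet.no-large-pdeg r′ s₁ b n G n-large sparse X ∣X∣≡s (≰⇒> X-dense) λ v → ≮⇒≥ λ small → ¬small (v , small)
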